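{- The following identities between permutation classes hold: (1) $\mathsf{Av}(2\underline{41}3, 3\underline{41}2, p_1)=\mathsf{Av}(2413, 3\underline{41}2)$; (2) $\mathsf{Av}(2\underline{41}3, 3\underline{14}2, p_1)=\mathsf{Av}(2413, 3\underline{14}2)$; (3) $\mathsf{Av}(3\underline{14}2, 2\underline{14}3, p_2)=\mathsf{Av}(3142, 2\underline{14}3)$; (4) $\mathsf{Av}(3\underline{14}2, 2\underline{41}3, p_2)=\mathsf{Av}(3142, 2\underline{41}3)$.
   Context: $\mathsf{Av}(\tau_1,\dots,\tau_p)$ denotes the set of permutations (of all sizes) avoiding all the listed patterns. A classical pattern $\tau\in S_k$ occurs in $\pi$ if some subsequence of $\pi$ is order-isomorphic to $\tau$. A vincular pattern is a classical pattern with some adjacent letters underlined; an occurrence additionally requires the entries matching underlined adjacent letters to be at adjacent positions of $\pi$. A mesh pattern $(\tau,\mu)$ with $\tau\in S_k$, $\mu\subseteq\{0,\dots,k\}^2$ occurs in $\pi\in S_n$ at positions $s_1<\dots<s_k$ if $\pi_{s_1}\cdots\pi_{s_k}$ is order-isomorphic to $\tau$ and, with $t_1<\dots<t_k$ the sorted values and $s_0=t_0=0$, $s_{k+1}=t_{k+1}=n+1$, for every $(i,j)\in\mu$ there is no $\ell$ with $s_i<\ell<s_{i+1}$ and $t_j<\pi_\ell<t_{j+1}$. $p_1=(25314,\{(0,3),(0,4),(1,3),(4,2),(5,1),(5,2)\})$ and $p_2=(41352,\{(0,1),(0,2),(1,2),(4,3),(5,3),(5,4)\})$. -}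

module Defs where

open import Data.Nat using (ℕ; zero; suc; _<_)
open import Data.Fin using (Fin; toℕ)
open import Data.Vec using (Vec; lookup; []; _∷_)
open import Data.List using (List; []; _∷_)
open import Data.List.Membership.Propositional using (_∈_)
open import Data.List.Relation.Unary.All using (All)
open import Data.Product using (Σ; _×_; _,_)
open import Data.Sum using (_⊎_)
open import Relation.Nullary using (¬_)
open import Relation.Binary.PropositionalEquality using (_≡_)
open import Function.Definitions using (Injective)
open import Function.Bundles using (_⇔_)
import Data.Fin as F

-- A permutation of size n: an injective (hence bijective) map
-- positions (0-indexed) ↦ values (0-indexed).
record Perm (n : ℕ) : Set where
  field
    π   : Fin n → Fin n
    inj : Injective _≡_ _≡_ π
open Perm public

-- Patterns are given in one-line notation with 1-indexed letters
-- (a Vec ℕ k holding a permutation of 1..k).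
-- vincular τ adj: adj lists the 1-indexed positions i such that letters
--   i and i+1 of τ are underlined together (must be adjacent in π).
-- mesh τ μ: μ lists the shaded boxes (i , j), 0 ≤ i , j ≤ k.
data Pattern : Set where
  classical : {k : ℕ} → Vec ℕ k → Pattern
  vincular  : {k : ℕ} → Vec ℕ k → List ℕ → Pattern
  mesh      : {k : ℕ} → Vec ℕ k → List (ℕ × ℕ) → Pattern

record ClassicalOcc {n k : ℕ} (σ : Perm n) (τ : Vec ℕ k) (s : Fin k → Fin n) : Set where
  field
    increasing : ∀ (a b : Fin k) → a F.< b → s a F.< s b
    orderIso   : ∀ (a b : Fin k) → (lookup τ a < lookup τ b) ⇔ (π σ (s a) F.< π σ (s b))

AdjOK : {n k : ℕ} → List ℕ → (Fin k → Fin n) → Set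
AdjOK {n} {k} adj s =
  ∀ (a b : Fin k) → suc (toℕ a) ∈ adj → toℕ b ≡ suc (toℕ a) →
  toℕ (s b) ≡ suc (toℕ (s a))

-- With the paper's 1-indexed conventions: positions of σ are 1..n,
-- s_i = 1 + toℕ (s (i-1)) for 1 ≤ i ≤ k, s_0 = 0, s_{k+1} = n+1;
-- t_j = the value (1-indexed) of the matched entry whose pattern letter is j,
-- t_0 = 0, t_{k+1} = n+1.
-- "s_i < p" for a 1-indexed position p:
PosAbove : {n k : ℕ} → (Fin k → Fin n) → ℕ → ℕ → Set
PosAbove {n} {k} s i p = i ≡ 0 ⊎ Σ (Fin k) (λ m → suc (toℕ m) ≡ i × suc (toℕ (s m)) < p)
-- "p < s_i":
PosBelow : {n k : ℕ} → (Fin k → Fin n) → ℕ → ℕ → Set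
PosBelow {n} {k} s i p = i ≡ suc k ⊎ Σ (Fin k) (λ m → suc (toℕ m) ≡ i × p < suc (toℕ (s m)))
-- "t_j < v" for a 1-indexed value v:
ValAbove : {n k : ℕ} → Perm n → Vec ℕ k → (Fin k → Fin n) → ℕ → ℕ → Set
ValAbove {n} {k} σ τ s j v = j ≡ 0 ⊎ Σ (Fin k) (λ m → lookup τ m ≡ j × suc (toℕ (π σ (s m))) < v)
-- "v < t_j":
ValBelow : {n k : ℕ} → Perm n → Vec ℕ k → (Fin k → Fin n) → ℕ → ℕ → Set
ValBelow {n} {k} σ τ s j v = j ≡ suc k ⊎ Σ (Fin k) (λ m → lookup τ m ≡ j × v < suc (toℕ (π σ (s m))))

BoxEmpty : {n k : ℕ} → Perm n → Vec ℕ k → (Fin k → Fin n) → ℕ × ℕ → Set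
BoxEmpty {n} {k} σ τ s (i , j) =
  ¬ Σ (Fin n) (λ ℓ →
      PosAbove s i (suc (toℕ ℓ)) × PosBelow s (suc i) (suc (toℕ ℓ)) ×
      ValAbove σ τ s j (suc (toℕ (π σ ℓ))) × ValBelow σ τ s (suc j) (suc (toℕ (π σ ℓ))))

Occurs : {n : ℕ} → Pattern → Perm n → Set
Occurs {n} (classical {k} τ) σ = Σ (Fin k → Fin n) (λ s → ClassicalOcc σ τ s)
Occurs {n} (vincular {k} τ adj) σ = Σ (Fin k → Fin n) (λ s → ClassicalOcc σ τ s × AdjOK adj s)
Occurs {n} (mesh {k} τ μ) σ =
  Σ (Fin k → Fin n) (λ s → ClassicalOcc σ τ s × (∀ b → b ∈ μ → BoxEmpty σ τ s b))

Av : List Pattern → {n : ℕ} → Perm n → Set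
Av ps σ = All (λ p → ¬ Occurs p σ) ps

SameClass : List Pattern → List Pattern → Set
SameClass A B = ∀ (n : ℕ) (σ : Perm n) → Av A σ ⇔ Av B σ

v2-41-3 v3-41-2 v3-14-2 v2-14-3 c2413 c3142 p1 p2 : Pattern
v2-41-3 = vincular (2 ∷ 4 ∷ 1 ∷ 3 ∷ []) (2 ∷ [])
v3-41-2 = vincular (3 ∷ 4 ∷ 1 ∷ 2 ∷ []) (2 ∷ [])
v3-14-2 = vincular (3 ∷ 1 ∷ 4 ∷ 2 ∷ []) (2 ∷ [])
v2-14-3 = vincular (2 ∷ 1 ∷ 4 ∷ 3 ∷ []) (2 ∷ [])
c2413 = classical (2 ∷ 4 ∷ 1 ∷ 3 ∷ [])
c3142 = classical (3 ∷ 1 ∷ 4 ∷ 2 ∷ [])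
p1 = mesh (2 ∷ 5 ∷ 3 ∷ 1 ∷ 4 ∷ [])
          ((0 , 3) ∷ (0 , 4) ∷ (1 , 3) ∷ (4 , 2) ∷ (5 , 1) ∷ (5 , 2) ∷ [])
p2 = mesh (4 ∷ 1 ∷ 3 ∷ 5 ∷ 2 ∷ [])
          ((0 , 1) ∷ (0 , 2) ∷ (1 , 2) ∷ (4 , 3) ∷ (5 , 3) ∷ (5 , 4) ∷ [])

-- Suppose σ avoids 2-41-3 and contains 2413. Between the 4 and the 1 the
-- values cross the level of the 2 downwards at some adjacent pair; avoidance of 2-41-3
-- puts the upper entry of that pair below the 3, which turns the 2413 into a 25314.
-- Among these occurrences take one whose 5 is lowest, then whose 1 is highest, then
-- whose 3 is highest. An entry in a shaded box of p₁ would, by the same kind of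
-- crossing argument and avoidance of 2-41-3 together with 3-41-2 (for (1)) or 3-14-2
-- (for (2)), yield a better occurrence; so the extremal one is an occurrence of p₁.
-- Conversely, 2-41-3 and p₁ both contain 2413. Identities (3) and (4) are the
-- reverses of (1) and (2).

module Submission where

open import Defs
open import Data.Nat
  using (ℕ; zero; suc; _+_; _∸_; _<_; _≤_; z≤n; s≤s; s≤s⁻¹; z<s; s<s; _<?_; _≤?_; _≟_)
open import Data.Nat.Properties
open import Data.Nat.Induction using (<-wellFounded)
open import Data.Fin using (Fin; toℕ; fromℕ<; opposite; #_)
import Data.Fin as F
open import Data.Fin.Properties
  using (toℕ-fromℕ<; fromℕ<-toℕ; toℕ-injective; toℕ<n; all?; opposite-prop; opposite-involutive)
open import Data.Vec using (Vec; lookup; []; _∷_; tabulate; map)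
open import Data.Vec.Properties using (lookup∘tabulate; lookup-map)
open import Data.List using (List; []; _∷_; length)
open import Data.List.Relation.Unary.Linked using (Linked; [-]; _∷_)
open import Data.List.Relation.Unary.Any using (here)
open import Data.List.Relation.Unary.All as All using (All; []; _∷_)
open import Data.List.Relation.Binary.Pointwise using (Pointwise; []; _∷_)
open import Data.List.Membership.Propositional using (_∈_)
open import Data.Product using (∃; _×_; _,_; proj₁; proj₂)
open import Data.Product.Properties using (≡-dec)
open import Data.List.Membership.DecPropositional (≡-dec _≟_ _≟_) using (_∈?_)
open import Data.Product.Relation.Binary.Lex.Strict using (×-Lex; ×-wellFounded)
open import Data.Sum using (_⊎_; inj₁; inj₂)
import Data.Sum as Sum
open import Data.Empty using (⊥; ⊥-elim)
open import Relation.Nullary using (¬_; Dec; yes; no)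
open import Relation.Nullary.Decidable using (from-yes; _×-dec_; _→-dec_)
open import Relation.Unary using (Decidable)
open import Relation.Binary.PropositionalEquality
  using (_≡_; _≢_; refl; sym; trans; cong; cong₂; subst; subst₂; module ≡-Reasoning)
import Relation.Binary.Construct.On as On
open import Induction.WellFounded using (Acc; acc; WellFounded; module Subrelation)
open import Function using (_∘_)
open import Function.Bundles using (_⇔_; mk⇔; Equivalence)
open import Function.Properties.Equivalence using () renaming (trans to ⇔-trans; sym to ⇔-sym)

crossing : (Q : ℕ → Set) → Decidable Q → ∀ {i j} → i < j → Q i → ¬ Q j →
           ∃ λ r → i ≤ r × r < j × Q r × ¬ Q (suc r)
crossing Q Q? {i} {suc j} (s≤s i≤j) Qi ¬Qj with Q? j
... | yes Qj = j , i≤j , ≤-refl , Qj , ¬Qj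
... | no ¬Q with crossing Q Q? (≤∧≢⇒< i≤j λ { refl → ¬Q Qi }) Qi ¬Q
...   | r , i≤r , r<j , Qr , ¬Qr = r , i≤r , m<n⇒m<1+n r<j , Qr , ¬Qr

outside⇒≢ : ∀ {ℓ p q r} → ℓ < p ⊎ q < ℓ → p ≤ r → r ≤ q → ℓ ≢ r
outside⇒≢ (inj₁ ℓ<p) p≤r _   refl = <⇒≱ ℓ<p p≤r
outside⇒≢ (inj₂ q<ℓ) _   r≤q refl = <⇒≱ q<ℓ r≤q

Increasing : (ℕ → ℕ) → Set
Increasing h = ∀ u → h u < h (suc u)

module _ {h : ℕ → ℕ} (h↑ : Increasing h) where

  increasing⇒mono-< : ∀ {u v} → u < v → h u < h v
  increasing⇒mono-< {u} (s≤s u≤v) with m≤n⇒m<n∨m≡n u≤v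
  ... | inj₁ u<v  = <-trans (increasing⇒mono-< u<v) (h↑ _)
  ... | inj₂ refl = h↑ u

  increasing⇒mono-≤ : ∀ {u v} → u ≤ v → h u ≤ h v
  increasing⇒mono-≤ u≤v with m≤n⇒m<n∨m≡n u≤v
  ... | inj₁ u<v  = <⇒≤ (increasing⇒mono-< u<v)
  ... | inj₂ refl = ≤-refl

  increasing⇒cancel-< : ∀ {u v} → h u < h v → u < v
  increasing⇒cancel-< hu<hv = ≰⇒> (<⇒≱ hu<hv ∘ increasing⇒mono-≤)

-- w ∷ ws read as a function on ℕ, continued with slope one so that it stays increasing.
enumerate : ℕ → List ℕ → ℕ → ℕ
enumerate w []        u       = u + w
enumerate w (w′ ∷ ws) zero    = w
enumerate w (w′ ∷ ws) (suc u) = enumerate w′ ws u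

enumerate-increasing : ∀ {w ws} → Linked _<_ (w ∷ ws) → Increasing (enumerate w ws)
enumerate-increasing {w} [-]           u       = n<1+n (u + w)
enumerate-increasing (w<w′ ∷ [-])      zero    = w<w′
enumerate-increasing (w<w′ ∷ (_ ∷ _))  zero    = w<w′
enumerate-increasing (_ ∷ ws↗)         (suc u) = enumerate-increasing ws↗ u

ranked : ℕ → List ℕ → ℕ → ℕ
ranked v vs zero    = zero
ranked v vs (suc u) = suc (enumerate v vs u)

ranked-increasing : ∀ {v vs} → Linked _<_ (v ∷ vs) → Increasing (ranked v vs)
ranked-increasing vs↗ zero    = s≤s z≤n
ranked-increasing vs↗ (suc u) = s≤s (enumerate-increasing vs↗ u)

enumerate-bounded : ∀ {n w ws} → Linked _<_ (w ∷ ws) → enumerate w ws (length ws) < n →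
                    (a : Fin (suc (length ws))) → enumerate w ws (toℕ a) < n
enumerate-bounded ws↗ last<n a =
  ≤-<-trans (increasing⇒mono-≤ (enumerate-increasing ws↗) (s≤s⁻¹ (toℕ<n a))) last<n

-- Sequences injective on an interval

module Sequence {n : ℕ} (f : ℕ → ℕ)
  (f-injective : ∀ {i j} → i < n → j < n → f i ≡ f j → i ≡ j) where

  -- The underlined pair of each vincular pattern sits at the adjacent positions j, j + 1.
  No2-41-3 No3-41-2 No3-14-2 : Set
  No2-41-3 = ∀ {i j l} → i < j → suc j < l → l < n → f (suc j) < f i → f i < f l → f l < f j → ⊥
  No3-41-2 = ∀ {i j l} → i < j → suc j < l → l < n → f (suc j) < f l → f l < f i → f i < f j → ⊥
  No3-14-2 = ∀ {i j l} → i < j → suc j < l → l < n → f j < f l → f l < f i → f i < f (suc j) → ⊥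

  ≤-at⇒< : ∀ {i j} → i < n → j < n → i ≢ j → f i ≤ f j → f i < f j
  ≤-at⇒< i<n j<n i≢j fi≤fj = ≤∧≢⇒< fi≤fj (i≢j ∘ f-injective i<n j<n)

  ≮⇒>-at : ∀ {i j} → i < n → j < n → i ≢ j → ¬ f i < f j → f j < f i
  ≮⇒>-at i<n j<n i≢j fi≮fj = ≤-at⇒< j<n i<n (i≢j ∘ sym) (≮⇒≥ fi≮fj)

  -- The level f ℓ is attained neither at r nor at r + 1, as ℓ lies outside [p, q].
  descent : ∀ {ℓ p q} → ℓ < n → q < n → ℓ < p ⊎ q < ℓ → p < q → f ℓ < f p → f q < f ℓ →
            ∃ λ r → p ≤ r × r < q × f (suc r) < f ℓ × f ℓ < f r
  descent {ℓ} ℓ<n q<n outside p<q fp fq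
    with crossing (λ r → f ℓ ≤ f r) (λ r → f ℓ ≤? f r) p<q (<⇒≤ fp) (<⇒≱ fq)
  ... | r , p≤r , r<q , fℓ≤fr , fr+1<fℓ =
    r , p≤r , r<q , ≰⇒> fr+1<fℓ
      , ≤-at⇒< ℓ<n (<-trans r<q q<n) (outside⇒≢ outside p≤r (<⇒≤ r<q)) fℓ≤fr

  ascent : ∀ {ℓ p q} → ℓ < n → q < n → ℓ < p ⊎ q < ℓ → p < q → f p < f ℓ → f ℓ < f q →
           ∃ λ r → p ≤ r × r < q × f r < f ℓ × f ℓ < f (suc r)
  ascent {ℓ} ℓ<n q<n outside p<q fp fq
    with crossing (λ r → f r < f ℓ) (λ r → f r <? f ℓ) p<q fp (<⇒≱ fq ∘ <⇒≤)
  ... | r , p≤r , r<q , fr<fℓ , fℓ≤fr+1 =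
    r , p≤r , r<q , fr<fℓ
      , ≤-at⇒< ℓ<n (≤-<-trans r<q q<n) (outside⇒≢ outside (m≤n⇒m≤1+n p≤r) r<q) (≮⇒≥ fℓ≤fr+1)

  -- An occurrence of 25314 in which b, d, x, a, c play the letters 2, 5, 3, 1, 4.
  record Occ : Set where
    field
      b d x a c : ℕ
      b<d : b < d
      d<x : d < x
      x<a : x < a
      a<c : a < c
      c<n : c < n
      fa<fb : f a < f b
      fb<fx : f b < f x
      fx<fc : f x < f c
      fc<fd : f c < f d

    a<n : a < n
    a<n = <-trans a<c c<n
    x<n : x < n
    x<n = <-trans x<a a<n
    d<n : d < n
    d<n = <-trans d<x x<n
    b<n : b < n
    b<n = <-trans b<d d<n

  open Occ

  data _≺_ (o′ o : Occ) : Set where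
    lower-d  : f (d o′) < f (d o) → o′ ≺ o
    higher-a : f (d o′) ≡ f (d o) → f (a o) < f (a o′) → o′ ≺ o
    higher-x : f (d o′) ≡ f (d o) → f (a o′) ≡ f (a o) → f (x o) < f (x o′) → o′ ≺ o

  ≺-wellFounded : WellFounded _≺_
  ≺-wellFounded = Subrelation.wellFounded ≺⇒lex (On.wellFounded key lex-wellFounded)
    where
    -- a and x are bounded above by d, so raising them lowers their distance to f d
    key : Occ → ℕ × ℕ × ℕ
    key o = f (d o) , f (d o) ∸ f (a o) , f (d o) ∸ f (x o)

    _<lex_ : ℕ × ℕ × ℕ → ℕ × ℕ × ℕ → Set
    _<lex_ = ×-Lex _≡_ _<_ (×-Lex _≡_ _<_ _<_)

    lex-wellFounded : WellFounded _<lex_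
    lex-wellFounded = ×-wellFounded <-wellFounded (×-wellFounded <-wellFounded <-wellFounded)

    ∸-lowered : ∀ {u u′ v v′} → v′ ≡ v → u < u′ → u′ < v′ → v′ ∸ u′ < v ∸ u
    ∸-lowered refl u<u′ u′<v = ∸-monoʳ-< u<u′ (<⇒≤ u′<v)

    ≺⇒lex : ∀ {o′ o} → o′ ≺ o → key o′ <lex key o
    ≺⇒lex (lower-d lt) = inj₁ lt
    ≺⇒lex {o′} (higher-a eq lt) =
      inj₂ (eq , inj₁ (∸-lowered eq lt (<-trans (fa<fb o′) (<-trans (fb<fx o′) fx<fd))))
      where
      fx<fd : f (x o′) < f (d o′)
      fx<fd = <-trans (fx<fc o′) (fc<fd o′)
    ≺⇒lex {o′} (higher-x eq eq′ lt) =
      inj₂ (eq , inj₂ (cong₂ _∸_ eq eq′ , ∸-lowered eq lt (<-trans (fx<fc o′) (fc<fd o′))))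

  InBox : ℕ → ℕ → ℕ → ℕ → ℕ → Set
  InBox lo hi u v ℓ = ℓ < hi × lo ≤ ℓ × u < f ℓ × f ℓ < v

  inBox? : ∀ lo hi u v → Dec (∃ (InBox lo hi u v))
  inBox? lo hi u v = anyUpTo? (λ ℓ → (lo ≤? ℓ) ×-dec (u <? f ℓ) ×-dec (f ℓ <? v)) hi

  -- The shaded boxes of p₁, merged where adjacent: (0,3) and (1,3) lie left of d,
  -- (0,4) left of b, (4,2) and (5,2) right of a, and (5,1) right of c.
  record Good (o : Occ) : Set where
    field
      left-of-d  : ¬ ∃ (InBox 0 (d o) (f (x o)) (f (c o)))
      left-of-b  : ¬ ∃ (InBox 0 (b o) (f (c o)) (f (d o)))
      right-of-a : ¬ ∃ (InBox (suc (a o)) n (f (b o)) (f (x o)))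
      right-of-c : ¬ ∃ (InBox (suc (c o)) n (f (a o)) (f (b o)))

  extend-2413 : No2-41-3 → ∀ {i j k l} → i < j → j < k → k < l → l < n →
                f k < f i → f i < f l → f l < f j → ∃ λ o → d o ≡ j
  extend-2413 no2-41-3 {i} {j} {k} {l} i<j j<k k<l l<n fk<fi fi<fl fl<fj
    with descent (<-trans i<j (<-trans j<k k<n)) k<n (inj₁ i<j) j<k (<-trans fi<fl fl<fj) fk<fi
    where k<n = <-trans k<l l<n
  ... | r , j≤r , r<k , fr+1<fi , fi<fr = o , refl
    where
    r+1<l : suc r < l
    r+1<l = ≤-<-trans r<k k<l
    fr<fl : f r < f l
    fr<fl = ≮⇒>-at l<n (<-trans r<k (<-trans k<l l<n)) (>⇒≢ (<-trans r<k k<l))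
              (no2-41-3 (<-≤-trans i<j j≤r) r+1<l l<n fr+1<fi fi<fl)
    o : Occ
    o = record
      { b = i ; d = j ; x = r ; a = suc r ; c = l
      ; b<d = i<j ; d<x = ≤∧≢⇒< j≤r (λ { refl → <-asym fr<fl fl<fj }) ; x<a = n<1+n r
      ; a<c = r+1<l ; c<n = l<n
      ; fa<fb = fr+1<fi ; fb<fx = fi<fr ; fx<fc = fr<fl ; fc<fd = fl<fj }

  module _ (o : Occ) where
    private
      x<c : x o < c o
      x<c = <-trans (x<a o) (a<c o)
      d<a : d o < a o
      d<a = <-trans (d<x o) (x<a o)

    improve-left-of-d : No2-41-3 → ∃ (InBox 0 (d o) (f (x o)) (f (c o))) → ∃ (_≺ o)
    improve-left-of-d no2-41-3 (ℓ , ℓ<d , _ , fx<fℓ , fℓ<fc)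
      with descent (<-trans ℓ<d (d<n o)) (a<n o) (inj₁ ℓ<d) d<a
                   (<-trans fℓ<fc (fc<fd o)) (<-trans (fa<fb o) (<-trans (fb<fx o) fx<fℓ))
    ... | r , d≤r , r<a , fr+1<fℓ , fℓ<fr = o′ , higher-x refl refl (<-trans fx<fℓ fℓ<fr)
      where
      fr<fc : f r < f (c o)
      fr<fc = ≮⇒>-at (c<n o) (<-trans r<a (a<n o)) (>⇒≢ (<-trans r<a (a<c o)))
                (no2-41-3 (<-≤-trans ℓ<d d≤r) (≤-<-trans r<a (a<c o)) (c<n o) fr+1<fℓ fℓ<fc)
      o′ : Occ
      o′ = record o
        { x = r ; d<x = ≤∧≢⇒< d≤r (λ { refl → <-asym fr<fc (fc<fd o) }) ; x<a = r<a
        ; fb<fx = <-trans (fb<fx o) (<-trans fx<fℓ fℓ<fr) ; fx<fc = fr<fc }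

    improve-right-of-a : No2-41-3 → ∃ (InBox (suc (a o)) n (f (b o)) (f (x o))) → ∃ (_≺ o)
    improve-right-of-a no2-41-3 (ℓ , ℓ<n , a<ℓ , fb<fℓ , fℓ<fx)
      with extend-2413 no2-41-3 (<-trans (b<d o) (d<x o)) (x<a o) a<ℓ ℓ<n (fa<fb o) fb<fℓ fℓ<fx
    ... | o′ , d′≡x = o′ , lower-d (subst (λ t → f t < f (d o)) (sym d′≡x) (<-trans (fx<fc o) (fc<fd o)))

    improve-left-of-b-via-3-41-2 : No2-41-3 → No3-41-2 → ∃ (InBox 0 (b o) (f (c o)) (f (d o))) → ∃ (_≺ o)
    improve-left-of-b-via-3-41-2 no2-41-3 no3-41-2 (ℓ , ℓ<b , _ , fc<fℓ , fℓ<fd)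
      with descent (c<n o) (x<n o) (inj₂ x<c) (d<x o) (fc<fd o) (fx<fc o)
    ... | r , d≤r , r<x , fr+1<fc , fc<fr = o′ , lower-d (<-trans fr<fℓ fℓ<fd)
      where
      b<r : b o < r
      b<r = <-≤-trans (b<d o) d≤r
      r+1<c : suc r < c o
      r+1<c = ≤-<-trans r<x x<c
      fr<fℓ : f r < f ℓ
      fr<fℓ = ≮⇒>-at (<-trans ℓ<b (b<n o)) (<-trans r<x (x<n o)) (<⇒≢ (<-trans ℓ<b b<r))
                (no3-41-2 (<-trans ℓ<b b<r) r+1<c (c<n o) fr+1<fc fc<fℓ)
      fb<fr+1 : f (b o) < f (suc r)
      fb<fr+1 = ≮⇒>-at (≤-<-trans r<x (x<n o)) (b<n o) (>⇒≢ (<-trans b<r (n<1+n r)))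
                  (λ fr+1<fb → no2-41-3 b<r r+1<c (c<n o) fr+1<fb (<-trans (fb<fx o) (fx<fc o)) fc<fr)
      o′ : Occ
      o′ = record o
        { d = r ; x = suc r ; b<d = b<r ; d<x = n<1+n r ; x<a = ≤-<-trans r<x (x<a o)
        ; fb<fx = fb<fr+1 ; fx<fc = fr+1<fc ; fc<fd = fc<fr }

    improve-left-of-b-via-3-14-2 : No3-14-2 → ∃ (InBox 0 (b o) (f (c o)) (f (d o))) → ∃ (_≺ o)
    improve-left-of-b-via-3-14-2 no3-14-2 (ℓ , ℓ<b , _ , fc<fℓ , fℓ<fd)
      with ascent (<-trans ℓ<b (b<n o)) (d<n o) (inj₁ ℓ<b) (b<d o)
                  (<-trans (fb<fx o) (<-trans (fx<fc o) fc<fℓ)) fℓ<fd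
    ... | r , b≤r , r<d , fr<fℓ , fℓ<fr+1 = o′ , lower-d (<-trans fr<fℓ fℓ<fd)
      where
      fc<fr : f (c o) < f r
      fc<fr = ≮⇒>-at (<-trans r<d (d<n o)) (c<n o) (<⇒≢ (<-trans r<d (<-trans (d<x o) x<c)))
                (λ fr<fc → no3-14-2 (<-≤-trans ℓ<b b≤r) (≤-<-trans r<d (<-trans (d<x o) x<c)) (c<n o)
                             fr<fc fc<fℓ fℓ<fr+1)
      o′ : Occ
      o′ = record o
        { d = r ; b<d = ≤∧≢⇒< b≤r (λ { refl → <-asym fc<fr (<-trans (fb<fx o) (fx<fc o)) })
        ; d<x = <-trans r<d (d<x o) ; fc<fd = fc<fr }

    improve-right-of-c-via-3-41-2 : No3-41-2 → ∃ (InBox (suc (c o)) n (f (a o)) (f (b o))) → ∃ (_≺ o)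
    improve-right-of-c-via-3-41-2 no3-41-2 (ℓ , ℓ<n , c<ℓ , fa<fℓ , fℓ<fb)
      with descent ℓ<n (a<n o) (inj₂ (<-trans (a<c o) c<ℓ)) (x<a o) (<-trans fℓ<fb (fb<fx o)) fa<fℓ
    ... | r , x≤r , r<a , fr+1<fℓ , fℓ<fr = o′ , higher-a refl (<-trans fa<fℓ fℓ<fr)
      where
      b<r : b o < r
      b<r = <-≤-trans (<-trans (b<d o) (d<x o)) x≤r
      fr<fb : f r < f (b o)
      fr<fb = ≮⇒>-at (b<n o) (<-trans r<a (a<n o)) (<⇒≢ b<r)
                (no3-41-2 b<r (≤-<-trans r<a (<-trans (a<c o) c<ℓ)) ℓ<n fr+1<fℓ fℓ<fb)
      o′ : Occ
      o′ = record o
        { a = r ; x<a = ≤∧≢⇒< x≤r (λ { refl → <-asym fr<fb (fb<fx o) }) ; a<c = <-trans r<a (a<c o)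
        ; fa<fb = fr<fb }

    improve-right-of-c-via-3-14-2 : No3-14-2 → ∃ (InBox (suc (c o)) n (f (a o)) (f (b o))) → ∃ (_≺ o)
    improve-right-of-c-via-3-14-2 no3-14-2 (ℓ , ℓ<n , c<ℓ , fa<fℓ , fℓ<fb)
      with ascent ℓ<n (c<n o) (inj₂ c<ℓ) (a<c o) fa<fℓ (<-trans fℓ<fb (<-trans (fb<fx o) (fx<fc o)))
    ... | r , a≤r , r<c , fr<fℓ , fℓ<fr+1 = o′ , higher-a refl (<-trans fa<fℓ fℓ<fr+1)
      where
      b<r : b o < r
      b<r = <-≤-trans (<-trans (b<d o) d<a) a≤r
      fr+1<fb : f (suc r) < f (b o)
      fr+1<fb = ≮⇒>-at (b<n o) (≤-<-trans r<c (c<n o)) (<⇒≢ (<-trans b<r (n<1+n r)))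
                  (no3-14-2 b<r (≤-<-trans r<c c<ℓ) ℓ<n fr<fℓ fℓ<fb)
      o′ : Occ
      o′ = record o
        { a = suc r ; x<a = <-≤-trans (x<a o) (m≤n⇒m≤1+n a≤r)
        ; a<c = ≤∧≢⇒< r<c (λ { refl → <-asym fr+1<fb (<-trans (fb<fx o) (fx<fc o)) })
        ; fa<fb = fr+1<fb }

  improve : No2-41-3 → No3-41-2 ⊎ No3-14-2 → (o : Occ) → Good o ⊎ ∃ (_≺ o)
  improve no2-41-3 no3-41-2⊎no3-14-2 o
    with inBox? 0 (d o) (f (x o)) (f (c o)) | inBox? 0 (b o) (f (c o)) (f (d o))
       | inBox? (suc (a o)) n (f (b o)) (f (x o)) | inBox? (suc (c o)) n (f (a o)) (f (b o))
       | no3-41-2⊎no3-14-2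
  ... | yes e | _     | _     | _     | _ = inj₂ (improve-left-of-d o no2-41-3 e)
  ... | no _  | yes e | _     | _     | inj₁ no3-41-2 = inj₂ (improve-left-of-b-via-3-41-2 o no2-41-3 no3-41-2 e)
  ... | no _  | yes e | _     | _     | inj₂ no3-14-2 = inj₂ (improve-left-of-b-via-3-14-2 o no3-14-2 e)
  ... | no _  | no _  | yes e | _     | _ = inj₂ (improve-right-of-a o no2-41-3 e)
  ... | no _  | no _  | no _  | yes e | inj₁ no3-41-2 = inj₂ (improve-right-of-c-via-3-41-2 o no3-41-2 e)
  ... | no _  | no _  | no _  | yes e | inj₂ no3-14-2 = inj₂ (improve-right-of-c-via-3-14-2 o no3-14-2 e)
  ... | no e₁ | no e₂ | no e₃ | no e₄ | _ = inj₁ (record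
    { left-of-d = e₁ ; left-of-b = e₂ ; right-of-a = e₃ ; right-of-c = e₄ })

  good-occurrence : No2-41-3 → No3-41-2 ⊎ No3-14-2 → Occ → ∃ Good
  good-occurrence no2-41-3 no3-41-2⊎no3-14-2 o = go o (≺-wellFounded o)
    where
    go : (o : Occ) → Acc _≺_ o → ∃ Good
    go o (acc smaller) with improve no2-41-3 no3-41-2⊎no3-14-2 o
    ... | inj₁ good     = o , good
    ... | inj₂ (o′ , o′≺o) = go o′ (smaller o′≺o)

-- Occurrences in permutations

-- Junk value 0 outside the positions [0, n).
value : ∀ {n} → Perm n → ℕ → ℕ
value {n} σ i with i <? n
... | yes i<n = toℕ (π σ (fromℕ< i<n))
... | no  _   = 0

module _ {n} (σ : Perm n) where
  open ≡-Reasoning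

  value-fromℕ< : ∀ {i} (i<n : i < n) → value σ i ≡ toℕ (π σ (fromℕ< i<n))
  value-fromℕ< {i} i<n with i <? n
  ... | yes _   = refl
  ... | no  i≮n = ⊥-elim (i≮n i<n)

  value-toℕ : (ℓ : Fin n) → value σ (toℕ ℓ) ≡ toℕ (π σ ℓ)
  value-toℕ ℓ = trans (value-fromℕ< (toℕ<n ℓ)) (cong (toℕ ∘ π σ) (fromℕ<-toℕ ℓ (toℕ<n ℓ)))

  value-injective : ∀ {i j} → i < n → j < n → value σ i ≡ value σ j → i ≡ j
  value-injective {i} {j} i<n j<n eq = begin
    i                      ≡⟨ toℕ-fromℕ< i<n ⟨
    toℕ (fromℕ< i<n)       ≡⟨ cong toℕ (inj σ (toℕ-injective same-value)) ⟩
    toℕ (fromℕ< j<n)       ≡⟨ toℕ-fromℕ< j<n ⟩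
    j                      ∎
    where
    same-value : toℕ (π σ (fromℕ< i<n)) ≡ toℕ (π σ (fromℕ< j<n))
    same-value = trans (sym (value-fromℕ< i<n)) (trans eq (value-fromℕ< j<n))

  -- Pattern letters start at 1, so they are matched with the successors of the values.
  classical-occurrence : ∀ {k} (τ : Vec ℕ k) {pos rank : ℕ → ℕ} →
    Increasing pos → Increasing rank → (pos<n : ∀ a → pos (toℕ a) < n) →
    tabulate (λ a → suc (value σ (pos (toℕ a)))) ≡ map rank τ →
    ClassicalOcc σ τ (λ a → fromℕ< (pos<n a))
  classical-occurrence {k} τ {pos} {rank} pos↑ rank↑ pos<n ranks = record
    { increasing = λ a b →
        subst₂ _<_ (sym (toℕ-fromℕ< (pos<n a))) (sym (toℕ-fromℕ< (pos<n b))) ∘ increasing⇒mono-< pos↑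
    ; orderIso = λ a b → mk⇔ (to a b) (from a b) }
    where
    π-at value+1 : Fin k → ℕ
    π-at a = toℕ (π σ (fromℕ< (pos<n a)))
    value+1 a = suc (value σ (pos (toℕ a)))

    rank-at : ∀ a → suc (π-at a) ≡ rank (lookup τ a)
    rank-at a = begin
      suc (π-at a)                ≡⟨ cong suc (value-fromℕ< (pos<n a)) ⟨
      value+1 a                   ≡⟨ lookup∘tabulate value+1 a ⟨
      lookup (tabulate value+1) a ≡⟨ cong (λ v → lookup v a) ranks ⟩
      lookup (map rank τ) a       ≡⟨ lookup-map a rank τ ⟩
      rank (lookup τ a)           ∎

    to : ∀ a b → lookup τ a < lookup τ b → π-at a < π-at b
    to a b = s≤s⁻¹ ∘ subst₂ _<_ (sym (rank-at a)) (sym (rank-at b)) ∘ increasing⇒mono-< rank↑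

    from : ∀ a b → π-at a < π-at b → lookup τ a < lookup τ b
    from a b = increasing⇒cancel-< rank↑ ∘ subst₂ _<_ (rank-at a) (rank-at b) ∘ s≤s

middle-adjacent : ∀ {n} {s : Fin 4 → Fin n} →
                  AdjOK (2 ∷ []) s ⇔ toℕ (s (# 2)) ≡ suc (toℕ (s (# 1)))
middle-adjacent {s = s} = mk⇔ (λ adj → adj (# 1) (# 2) (here refl) refl) from
  where
  from : toℕ (s (# 2)) ≡ suc (toℕ (s (# 1))) → AdjOK (2 ∷ []) s
  from adjacent a b (here 1+a≡2) b≡1+a
    with toℕ-injective {i = a} {# 1} (suc-injective 1+a≡2)
       | toℕ-injective {i = b} {# 2} (trans b≡1+a 1+a≡2)
  ... | refl | refl = adjacent

module _ {n} (σ : Perm n) where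

  vincular-occurrence : (τ : Vec ℕ 4) → ∀ {i j l} → i < j → suc j < l → l < n →
    ∀ {v₁ v₂ v₃ v₄} → Linked _<_ (v₁ ∷ v₂ ∷ v₃ ∷ v₄ ∷ []) →
    tabulate (λ a → suc (value σ (enumerate i (j ∷ suc j ∷ l ∷ []) (toℕ a))))
      ≡ map (ranked v₁ (v₂ ∷ v₃ ∷ v₄ ∷ [])) τ →
    Occurs (vincular τ (2 ∷ [])) σ
  vincular-occurrence τ {i} {j} {l} i<j j+1<l l<n vs↗ ranks =
    _ , classical-occurrence σ τ pos↑ (ranked-increasing vs↗) pos<n ranks
      , Equivalence.from middle-adjacent
          (trans (toℕ-fromℕ< (pos<n (# 2))) (cong suc (sym (toℕ-fromℕ< (pos<n (# 1))))))
    where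
    pos↗ : Linked _<_ (i ∷ j ∷ suc j ∷ l ∷ [])
    pos↗ = i<j ∷ n<1+n j ∷ j+1<l ∷ [-]
    pos↑ : Increasing (enumerate i (j ∷ suc j ∷ l ∷ []))
    pos↑ = enumerate-increasing pos↗
    pos<n : ∀ a → enumerate i (j ∷ suc j ∷ l ∷ []) (toℕ a) < n
    pos<n = enumerate-bounded pos↗ l<n

  open Sequence (value σ) (value-injective σ)

  avoid-2-41-3 : ¬ Occurs v2-41-3 σ → No2-41-3
  avoid-2-41-3 ¬occ i<j j+1<l l<n v₁<v₂ v₂<v₃ v₃<v₄ =
    ¬occ (vincular-occurrence _ i<j j+1<l l<n (v₁<v₂ ∷ v₂<v₃ ∷ v₃<v₄ ∷ [-]) refl)

  avoid-3-41-2 : ¬ Occurs v3-41-2 σ → No3-41-2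
  avoid-3-41-2 ¬occ i<j j+1<l l<n v₁<v₂ v₂<v₃ v₃<v₄ =
    ¬occ (vincular-occurrence _ i<j j+1<l l<n (v₁<v₂ ∷ v₂<v₃ ∷ v₃<v₄ ∷ [-]) refl)

  avoid-3-14-2 : ¬ Occurs v3-14-2 σ → No3-14-2
  avoid-3-14-2 ¬occ i<j j+1<l l<n v₁<v₂ v₂<v₃ v₃<v₄ =
    ¬occ (vincular-occurrence _ i<j j+1<l l<n (v₁<v₂ ∷ v₂<v₃ ∷ v₃<v₄ ∷ [-]) refl)

  occurrence-2413⇒Occ : No2-41-3 → Occurs c2413 σ → Occ
  occurrence-2413⇒Occ no2-41-3 (s , occ) =
    proj₁ (extend-2413 no2-41-3 (position-< (# 0) (# 1) z<s) (position-< (# 1) (# 2) (s<s z<s))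
                                (position-< (# 2) (# 3) (s<s (s<s z<s))) (toℕ<n (s (# 3)))
                                (value-< (# 2) (# 0) (s<s z<s)) (value-< (# 0) (# 3) (s<s (s<s z<s)))
                                (value-< (# 3) (# 1) (s<s (s<s (s<s z<s)))))
    where
    open ClassicalOcc occ
    position-< : ∀ a b → a F.< b → toℕ (s a) < toℕ (s b)
    position-< = increasing
    value-< : ∀ a b → lookup (2 ∷ 4 ∷ 1 ∷ 3 ∷ []) a < lookup (2 ∷ 4 ∷ 1 ∷ 3 ∷ []) b →
              value σ (toℕ (s a)) < value σ (toℕ (s b))
    value-< a b =
      subst₂ _<_ (sym (value-toℕ σ (s a))) (sym (value-toℕ σ (s b))) ∘ Equivalence.to (orderIso a b)

module _ {n k} {s : Fin k → Fin n} where

  pos-above : ∀ m {p} → PosAbove s (suc (toℕ m)) (suc p) → toℕ (s m) < p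
  pos-above m (inj₂ (m′ , 1+m′≡1+m , lt)) with toℕ-injective {i = m′} {m} (suc-injective 1+m′≡1+m)
  ... | refl = s≤s⁻¹ lt

  pos-below : ∀ m {p} → PosBelow s (suc (toℕ m)) (suc p) → p < toℕ (s m)
  pos-below m (inj₁ 1+m≡1+k) = ⊥-elim (<-irrefl (suc-injective 1+m≡1+k) (toℕ<n m))
  pos-below m (inj₂ (m′ , 1+m′≡1+m , lt)) with toℕ-injective {i = m′} {m} (suc-injective 1+m′≡1+m)
  ... | refl = s≤s⁻¹ lt

module ValueBounds {n k} (σ : Perm n) (τ : Vec ℕ k) (s : Fin k → Fin n)
         (τ-injective : ∀ {a b} → lookup τ a ≡ lookup τ b → a ≡ b) where

  val-above : ∀ m {j v} → lookup τ m ≡ suc j → ValAbove σ τ s (suc j) (suc v) →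
              toℕ (π σ (s m)) < v
  val-above m τm≡1+j (inj₂ (m′ , τm′≡1+j , lt))
    with τ-injective {m′} {m} (trans τm′≡1+j (sym τm≡1+j))
  ... | refl = s≤s⁻¹ lt

  val-below : ∀ m {j v} → lookup τ m ≡ j → j ≢ suc k → ValBelow σ τ s j (suc v) →
              v < toℕ (π σ (s m))
  val-below m τm≡j j≢1+k (inj₁ j≡1+k) = ⊥-elim (j≢1+k j≡1+k)
  val-below m τm≡j j≢1+k (inj₂ (m′ , τm′≡j , lt))
    with τ-injective {m′} {m} (trans τm′≡j (sym τm≡j))
  ... | refl = s≤s⁻¹ lt

module _ {n} (σ : Perm n) where
  open Sequence (value σ) (value-injective σ)

  p1-occurrence : (o : Occ) → Good o → Occurs p1 σ
  p1-occurrence o good =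
    s , occ , λ _ → All.lookup {P = BoxEmpty σ τ s}
                      (box₀₃ ∷ box₀₄ ∷ box₁₃ ∷ box₄₂ ∷ box₅₁ ∷ box₅₂ ∷ [])
    where
    open Occ o
    open Good good
    f : ℕ → ℕ
    f = value σ
    τ : Vec ℕ 5
    τ = 2 ∷ 5 ∷ 3 ∷ 1 ∷ 4 ∷ []
    pos : ℕ → ℕ
    pos = enumerate b (d ∷ x ∷ a ∷ c ∷ [])
    pos↗ : Linked _<_ (b ∷ d ∷ x ∷ a ∷ c ∷ [])
    pos↗ = b<d ∷ d<x ∷ x<a ∷ a<c ∷ [-]
    pos<n : ∀ (m : Fin 5) → pos (toℕ m) < n
    pos<n = enumerate-bounded pos↗ c<n
    s : Fin 5 → Fin n
    s m = fromℕ< (pos<n m)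
    occ : ClassicalOcc σ τ s
    occ = classical-occurrence σ τ (enumerate-increasing pos↗)
            (ranked-increasing (fa<fb ∷ fb<fx ∷ fx<fc ∷ fc<fd ∷ [-])) pos<n refl

    τ-injective : ∀ {a b} → lookup τ a ≡ lookup τ b → a ≡ b
    τ-injective = from-yes (all? λ a → all? λ b → (lookup τ a ≟ lookup τ b) →-dec (a F.≟ b)) _ _
    open ValueBounds σ τ s τ-injective

    left-of : ∀ m {ℓ : Fin n} → PosBelow s (suc (toℕ m)) (suc (toℕ ℓ)) → toℕ ℓ < pos (toℕ m)
    left-of m = subst (_ <_) (toℕ-fromℕ< (pos<n m)) ∘ pos-below m
    right-of : ∀ m {ℓ : Fin n} → PosAbove s (suc (toℕ m)) (suc (toℕ ℓ)) → pos (toℕ m) < toℕ ℓ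
    right-of m = subst (_< _) (toℕ-fromℕ< (pos<n m)) ∘ pos-above m
    above : ∀ m {j} {ℓ : Fin n} → lookup τ m ≡ suc j → ValAbove σ τ s (suc j) (suc (toℕ (π σ ℓ))) →
            f (pos (toℕ m)) < f (toℕ ℓ)
    above m {ℓ = ℓ} τm≡1+j =
      subst₂ _<_ (sym (value-fromℕ< σ (pos<n m))) (sym (value-toℕ σ ℓ)) ∘ val-above m τm≡1+j
    below : ∀ m {j} {ℓ : Fin n} → lookup τ m ≡ j → j ≢ 6 → ValBelow σ τ s j (suc (toℕ (π σ ℓ))) →
            f (toℕ ℓ) < f (pos (toℕ m))
    below m {ℓ = ℓ} τm≡j j≢6 =
      subst₂ _<_ (sym (value-toℕ σ ℓ)) (sym (value-fromℕ< σ (pos<n m))) ∘ val-below m τm≡j j≢6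

    box₀₃ : BoxEmpty σ τ s (0 , 3)
    box₀₃ (ℓ , _ , ℓ<b , x<ℓ , ℓ<c) =
      left-of-d (toℕ ℓ , <-trans (left-of (# 0) ℓ<b) b<d , z≤n
                , above (# 2) refl x<ℓ , below (# 4) refl (λ ()) ℓ<c)
    box₀₄ : BoxEmpty σ τ s (0 , 4)
    box₀₄ (ℓ , _ , ℓ<b , c<ℓ , ℓ<d) =
      left-of-b (toℕ ℓ , left-of (# 0) ℓ<b , z≤n
                , above (# 4) refl c<ℓ , below (# 1) refl (λ ()) ℓ<d)
    box₁₃ : BoxEmpty σ τ s (1 , 3)
    box₁₃ (ℓ , _ , ℓ<d , x<ℓ , ℓ<c) =
      left-of-d (toℕ ℓ , left-of (# 1) ℓ<d , z≤n
                , above (# 2) refl x<ℓ , below (# 4) refl (λ ()) ℓ<c)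
    box₄₂ : BoxEmpty σ τ s (4 , 2)
    box₄₂ (ℓ , a<ℓ , _ , b<ℓ , ℓ<x) =
      right-of-a (toℕ ℓ , toℕ<n ℓ , right-of (# 3) a<ℓ
                 , above (# 0) refl b<ℓ , below (# 2) refl (λ ()) ℓ<x)
    box₅₁ : BoxEmpty σ τ s (5 , 1)
    box₅₁ (ℓ , c<ℓ , _ , a<ℓ , ℓ<b) =
      right-of-c (toℕ ℓ , toℕ<n ℓ , right-of (# 4) c<ℓ
                 , above (# 3) refl a<ℓ , below (# 0) refl (λ ()) ℓ<b)
    box₅₂ : BoxEmpty σ τ s (5 , 2)
    box₅₂ (ℓ , c<ℓ , _ , b<ℓ , ℓ<x) =
      right-of-a (toℕ ℓ , toℕ<n ℓ , <-trans a<c (right-of (# 4) c<ℓ)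
                 , above (# 0) refl b<ℓ , below (# 2) refl (λ ()) ℓ<x)

-- Identities (1) and (2)

module _ {n k k′} {σ : Perm n} {τ : Vec ℕ k} {τ′ : Vec ℕ k′} {s : Fin k → Fin n}
         (ι : Fin k′ → Fin k) (ι-increasing : ∀ a b → a F.< b → ι a F.< ι b)
         (ι-order : ∀ a b → (lookup τ′ a < lookup τ′ b → lookup τ (ι a) < lookup τ (ι b))
                          × (lookup τ (ι a) < lookup τ (ι b) → lookup τ′ a < lookup τ′ b)) where

  ClassicalOcc-∘ : ClassicalOcc σ τ s → ClassicalOcc σ τ′ (s ∘ ι)
  ClassicalOcc-∘ occ = record
    { increasing = λ a b → increasing (ι a) (ι b) ∘ ι-increasing a b
    ; orderIso = λ a b → mk⇔ (Equivalence.to (orderIso (ι a) (ι b)) ∘ proj₁ (ι-order a b))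
                              (proj₂ (ι-order a b) ∘ Equivalence.from (orderIso (ι a) (ι b))) }
    where open ClassicalOcc occ

p1⇒2413 : ∀ {n} {σ : Perm n} → Occurs p1 σ → Occurs c2413 σ
p1⇒2413 (s , occ , _) = s ∘ ι , ClassicalOcc-∘ ι ι-increasing ι-order occ
  where
  τ : Vec ℕ 5
  τ = 2 ∷ 5 ∷ 3 ∷ 1 ∷ 4 ∷ []
  τ′ : Vec ℕ 4
  τ′ = 2 ∷ 4 ∷ 1 ∷ 3 ∷ []
  ι : Fin 4 → Fin 5
  ι = lookup (# 0 ∷ # 1 ∷ # 3 ∷ # 4 ∷ [])
  ι-increasing : ∀ a b → a F.< b → ι a F.< ι b
  ι-increasing = from-yes (all? λ a → all? λ b → (a F.<? b) →-dec (ι a F.<? ι b))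
  ι-order : ∀ a b → (lookup τ′ a < lookup τ′ b → lookup τ (ι a) < lookup τ (ι b))
                  × (lookup τ (ι a) < lookup τ (ι b) → lookup τ′ a < lookup τ′ b)
  ι-order = from-yes (all? λ a → all? λ b →
    ((lookup τ′ a <? lookup τ′ b) →-dec (lookup τ (ι a) <? lookup τ (ι b)))
    ×-dec ((lookup τ (ι a) <? lookup τ (ι b)) →-dec (lookup τ′ a <? lookup τ′ b)))

vincular⇒classical : ∀ {n k} {σ : Perm n} {τ : Vec ℕ k} {adj} →
                     Occurs (vincular τ adj) σ → Occurs (classical τ) σ
vincular⇒classical (s , occ , _) = s , occ

p1-from-2413 : ∀ {n} (σ : Perm n) → let open Sequence (value σ) (value-injective σ) in
               No2-41-3 → No3-41-2 ⊎ No3-14-2 → Occurs c2413 σ → Occurs p1 σ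
p1-from-2413 σ no2-41-3 no3-41-2⊎no3-14-2 occ =
  let o , good = good-occurrence no2-41-3 no3-41-2⊎no3-14-2 (occurrence-2413⇒Occ σ no2-41-3 occ)
  in p1-occurrence σ o good
  where open Sequence (value σ) (value-injective σ)

SameClass-p1-2413 : (q : Pattern) →
  (∀ {n} (σ : Perm n) → ¬ Occurs q σ →
     let open Sequence (value σ) (value-injective σ) in No3-41-2 ⊎ No3-14-2) →
  SameClass (v2-41-3 ∷ q ∷ p1 ∷ []) (c2413 ∷ q ∷ [])
SameClass-p1-2413 q q-second n σ = mk⇔
  (λ { (¬v2-41-3 ∷ ¬q ∷ ¬p1 ∷ []) →
         ¬p1 ∘ p1-from-2413 σ (avoid-2-41-3 σ ¬v2-41-3) (q-second σ ¬q) ∷ ¬q ∷ [] })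
  (λ { (¬2413 ∷ ¬q ∷ []) → ¬2413 ∘ vincular⇒classical ∷ ¬q ∷ ¬2413 ∘ p1⇒2413 ∷ [] })

identity₁ : SameClass (v2-41-3 ∷ v3-41-2 ∷ p1 ∷ []) (c2413 ∷ v3-41-2 ∷ [])
identity₁ = SameClass-p1-2413 v3-41-2 λ σ → inj₁ ∘ avoid-3-41-2 σ

identity₂ : SameClass (v2-41-3 ∷ v3-14-2 ∷ p1 ∷ []) (c2413 ∷ v3-14-2 ∷ [])
identity₂ = SameClass-p1-2413 v3-14-2 λ σ → inj₂ ∘ avoid-3-14-2 σ

-- Reversal

opposite-injective : ∀ {k} {a b : Fin k} → opposite a ≡ opposite b → a ≡ b
opposite-injective {a = a} {b} eq =
  trans (sym (opposite-involutive a)) (trans (cong opposite eq) (opposite-involutive b))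

opposite-< : ∀ {k} {a b : Fin k} → a F.< b → opposite b F.< opposite a
opposite-< {k} {a} {b} a<b =
  subst₂ _<_ (sym (opposite-prop b)) (sym (opposite-prop a)) (∸-monoʳ-< (s≤s a<b) (toℕ<n b))

<opposite⇒<opposite : ∀ {k} {a b : Fin k} → a F.< opposite b → b F.< opposite a
<opposite⇒<opposite {a = a} {b} = subst (F._< opposite a) (opposite-involutive b) ∘ opposite-<

opposite<⇒opposite< : ∀ {k} {a b : Fin k} → opposite a F.< b → opposite b F.< a
opposite<⇒opposite< {a = a} {b} = subst (opposite b F.<_) (opposite-involutive a) ∘ opposite-<

suc-opposite : ∀ {k} (a : Fin k) → suc (toℕ (opposite a)) ≡ k ∸ toℕ a
suc-opposite {k} a = trans (cong suc (opposite-prop a)) (sym (+-∸-assoc 1 (toℕ<n a)))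

opposite-adjacent : ∀ {n} {a b : Fin n} → toℕ b ≡ suc (toℕ a) →
                    toℕ (opposite a) ≡ suc (toℕ (opposite b))
opposite-adjacent {n} {a} {b} b≡1+a = begin
  toℕ (opposite a)       ≡⟨ opposite-prop a ⟩
  n ∸ suc (toℕ a)        ≡⟨ cong (n ∸_) b≡1+a ⟨
  n ∸ toℕ b              ≡⟨ suc-opposite b ⟨
  suc (toℕ (opposite b)) ∎
  where open ≡-Reasoning

reverse : ∀ {n} → Perm n → Perm n
reverse σ = record { π = π σ ∘ opposite ; inj = opposite-injective ∘ inj σ }

Reversed : ∀ {k} {A : Set} → (Fin k → A) → (Fin k → A) → Set
Reversed g h = ∀ a → g a ≡ h (opposite a)

reversed-sym : ∀ {k} {A : Set} {g h : Fin k → A} → Reversed g h → Reversed h g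
reversed-sym {h = h} g≡h a = trans (cong h (sym (opposite-involutive a))) (sym (g≡h (opposite a)))

mirror : ∀ {k n} → (Fin k → Fin n) → Fin k → Fin n
mirror s = opposite ∘ s ∘ opposite

-- Reversing a pattern of length k moves its box (i , j) to (k ∸ i , j).
MirroredIn : ℕ → List (ℕ × ℕ) → ℕ × ℕ → Set
MirroredIn k μ (i , j) = i ≤ k × (k ∸ i , j) ∈ μ

module _ {n k} {σ σ′ : Perm n} {τ τ′ : Vec ℕ k}
         (σ′-reversed : Reversed (π σ′) (π σ)) (τ′-reversed : Reversed (lookup τ′) (lookup τ)) where

  π-mirror : ∀ (s : Fin k → Fin n) a → π σ′ (mirror s a) ≡ π σ (s (opposite a))
  π-mirror s a = trans (σ′-reversed _) (cong (π σ) (opposite-involutive _))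

  mirror-classical : ∀ {s} → ClassicalOcc σ τ s → ClassicalOcc σ′ τ′ (mirror s)
  mirror-classical {s} occ = record
    { increasing = λ a b → opposite-< ∘ increasing (opposite b) (opposite a) ∘ opposite-<
    ; orderIso = λ a b → mk⇔
        (subst₂ F._<_ (sym (π-mirror s a)) (sym (π-mirror s b))
           ∘ Equivalence.to (orderIso (opposite a) (opposite b))
           ∘ subst₂ _<_ (τ′-reversed a) (τ′-reversed b))
        (subst₂ _<_ (sym (τ′-reversed a)) (sym (τ′-reversed b))
           ∘ Equivalence.from (orderIso (opposite a) (opposite b))
           ∘ subst₂ F._<_ (π-mirror s a) (π-mirror s b)) }
    where open ClassicalOcc occ

  module _ {s : Fin k → Fin n} {i : ℕ} (i≤k : i ≤ k) {ℓ : Fin n} where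

    right-of-mirror : PosBelow (mirror s) (suc (k ∸ i)) (suc (toℕ ℓ)) →
                      PosAbove s i (suc (toℕ (opposite ℓ)))
    right-of-mirror (inj₁ 1+k∸i≡1+k) =
      inj₁ (trans (sym (m∸[m∸n]≡n i≤k)) (trans (cong (k ∸_) (suc-injective 1+k∸i≡1+k)) (n∸n≡0 k)))
    right-of-mirror (inj₂ (m , 1+m≡1+k∸i , ℓ<m′)) =
      inj₂ (opposite m
           , trans (suc-opposite m) (trans (cong (k ∸_) (suc-injective 1+m≡1+k∸i)) (m∸[m∸n]≡n i≤k))
           , s≤s (<opposite⇒<opposite (s≤s⁻¹ ℓ<m′)))

    left-of-mirror : PosAbove (mirror s) (k ∸ i) (suc (toℕ ℓ)) →
                     PosBelow s (suc i) (suc (toℕ (opposite ℓ)))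
    left-of-mirror (inj₁ k∸i≡0) = inj₁ (cong suc (≤-antisym i≤k (m∸n≡0⇒m≤n k∸i≡0)))
    left-of-mirror (inj₂ (m , 1+m≡k∸i , m′<ℓ)) =
      inj₂ (opposite m
           , cong suc (trans (opposite-prop m) (trans (cong (k ∸_) 1+m≡k∸i) (m∸[m∸n]≡n i≤k)))
           , s≤s (opposite<⇒opposite< (s≤s⁻¹ m′<ℓ)))

  module _ {s : Fin k → Fin n} {j : ℕ} {ℓ : Fin n} where

    above-mirror : ValAbove σ′ τ′ (mirror s) j (suc (toℕ (π σ′ ℓ))) →
                   ValAbove σ τ s j (suc (toℕ (π σ (opposite ℓ))))
    above-mirror = Sum.map₂ λ (m , τ′m≡j , lt) →
      opposite m , trans (sym (τ′-reversed m)) τ′m≡j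
                 , subst₂ (λ u v → suc (toℕ u) < suc (toℕ v)) (π-mirror s m) (σ′-reversed ℓ) lt

    below-mirror : ValBelow σ′ τ′ (mirror s) j (suc (toℕ (π σ′ ℓ))) →
                   ValBelow σ τ s j (suc (toℕ (π σ (opposite ℓ))))
    below-mirror = Sum.map₂ λ (m , τ′m≡j , lt) →
      opposite m , trans (sym (τ′-reversed m)) τ′m≡j
                 , subst₂ (λ u v → suc (toℕ v) < suc (toℕ u)) (π-mirror s m) (σ′-reversed ℓ) lt

  mirror-box : ∀ {s i j} → i ≤ k → BoxEmpty σ τ s (i , j) → BoxEmpty σ′ τ′ (mirror s) (k ∸ i , j)
  mirror-box i≤k empty (ℓ , right , left , above , below) =
    empty (opposite ℓ , right-of-mirror i≤k left , left-of-mirror i≤k right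
                      , above-mirror above , below-mirror below)

  mirror-mesh : ∀ {μ μ′} → All (MirroredIn k μ) μ′ → Occurs (mesh τ μ) σ → Occurs (mesh τ′ μ′) σ′
  mirror-mesh mirrored (s , occ , empty) = mirror s , mirror-classical occ , empty′
    where
    empty′ : ∀ box → box ∈ _ → BoxEmpty σ′ τ′ (mirror s) box
    empty′ (i , j) box∈μ′ with All.lookup mirrored box∈μ′
    ... | i≤k , mirrored∈μ = subst (λ i′ → BoxEmpty σ′ τ′ (mirror s) (i′ , j)) (m∸[m∸n]≡n i≤k)
                                   (mirror-box (m∸n≤m k i) (empty _ mirrored∈μ))

mirror-middle-adjacent : ∀ {n} {s : Fin 4 → Fin n} → AdjOK (2 ∷ []) s → AdjOK (2 ∷ []) (mirror s)
mirror-middle-adjacent = Equivalence.from middle-adjacent ∘ opposite-adjacent ∘ Equivalence.to middle-adjacent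

_Reverses_ : Pattern → Pattern → Set
p′ Reverses p = ∀ {n} (σ : Perm n) → Occurs p′ σ ⇔ Occurs p (reverse σ)

π-reverse : ∀ {n} (σ : Perm n) → Reversed (π (reverse σ)) (π σ)
π-reverse σ _ = refl

classical-reverses : ∀ {k} {τ τ′ : Vec ℕ k} → Reversed (lookup τ′) (lookup τ) →
                     classical τ′ Reverses classical τ
classical-reverses τ′-reversed σ = mk⇔
  (λ (s , occ) → mirror s , mirror-classical (π-reverse σ) (reversed-sym τ′-reversed) occ)
  (λ (s , occ) → mirror s , mirror-classical (reversed-sym (π-reverse σ)) τ′-reversed occ)

vincular-middle-reverses : ∀ {τ τ′ : Vec ℕ 4} → Reversed (lookup τ′) (lookup τ) →
                           vincular τ′ (2 ∷ []) Reverses vincular τ (2 ∷ [])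
vincular-middle-reverses τ′-reversed σ = mk⇔
  (λ (s , occ , adj) → mirror s , mirror-classical (π-reverse σ) (reversed-sym τ′-reversed) occ
                                 , mirror-middle-adjacent adj)
  (λ (s , occ , adj) → mirror s , mirror-classical (reversed-sym (π-reverse σ)) τ′-reversed occ
                                 , mirror-middle-adjacent adj)

mesh-reverses : ∀ {k} {τ τ′ : Vec ℕ k} {μ μ′} → Reversed (lookup τ′) (lookup τ) →
                All (MirroredIn k μ) μ′ → All (MirroredIn k μ′) μ → mesh τ′ μ′ Reverses mesh τ μ
mesh-reverses τ′-reversed μ′-mirrored μ-mirrored σ = mk⇔
  (mirror-mesh (π-reverse σ) (reversed-sym τ′-reversed) μ-mirrored)
  (mirror-mesh (reversed-sym (π-reverse σ)) τ′-reversed μ′-mirrored)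

Av-reverse : ∀ {A′ A} → Pointwise _Reverses_ A′ A → ∀ {n} (σ : Perm n) → Av A′ σ ⇔ Av A (reverse σ)
Av-reverse []       σ = mk⇔ (λ _ → []) (λ _ → [])
Av-reverse (r ∷ rs) σ = mk⇔
  (λ { (¬p′ ∷ av) → ¬p′ ∘ Equivalence.from (r σ) ∷ Equivalence.to (Av-reverse rs σ) av })
  (λ { (¬p ∷ av) → ¬p ∘ Equivalence.to (r σ) ∷ Equivalence.from (Av-reverse rs σ) av })

SameClass-reverse : ∀ {A′ A B′ B} → Pointwise _Reverses_ A′ A → Pointwise _Reverses_ B′ B →
                    SameClass A B → SameClass A′ B′
SameClass-reverse rA rB same n σ =
  ⇔-trans (Av-reverse rA σ) (⇔-trans (same n (reverse σ)) (⇔-sym (Av-reverse rB σ)))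

reversed? : ∀ {k} (τ′ τ : Vec ℕ k) → Dec (Reversed (lookup τ′) (lookup τ))
reversed? τ′ τ = all? λ a → lookup τ′ a ≟ lookup τ (opposite a)

3142-reverses-2413 : c3142 Reverses c2413
3142-reverses-2413 =
  classical-reverses (from-yes (reversed? (3 ∷ 1 ∷ 4 ∷ 2 ∷ []) (2 ∷ 4 ∷ 1 ∷ 3 ∷ [])))

3-14-2-reverses-2-41-3 : v3-14-2 Reverses v2-41-3
3-14-2-reverses-2-41-3 =
  vincular-middle-reverses (from-yes (reversed? (3 ∷ 1 ∷ 4 ∷ 2 ∷ []) (2 ∷ 4 ∷ 1 ∷ 3 ∷ [])))

2-41-3-reverses-3-14-2 : v2-41-3 Reverses v3-14-2
2-41-3-reverses-3-14-2 =
  vincular-middle-reverses (from-yes (reversed? (2 ∷ 4 ∷ 1 ∷ 3 ∷ []) (3 ∷ 1 ∷ 4 ∷ 2 ∷ [])))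

2-14-3-reverses-3-41-2 : v2-14-3 Reverses v3-41-2
2-14-3-reverses-3-41-2 =
  vincular-middle-reverses (from-yes (reversed? (2 ∷ 1 ∷ 4 ∷ 3 ∷ []) (3 ∷ 4 ∷ 1 ∷ 2 ∷ [])))

p2-reverses-p1 : p2 Reverses p1
p2-reverses-p1 =
  mesh-reverses (from-yes (reversed? τ₂ τ₁)) (from-yes (mirrored? μ₁ μ₂)) (from-yes (mirrored? μ₂ μ₁))
  where
  τ₁ τ₂ : Vec ℕ 5
  τ₁ = 2 ∷ 5 ∷ 3 ∷ 1 ∷ 4 ∷ []
  τ₂ = 4 ∷ 1 ∷ 3 ∷ 5 ∷ 2 ∷ []
  μ₁ μ₂ : List (ℕ × ℕ)
  μ₁ = (0 , 3) ∷ (0 , 4) ∷ (1 , 3) ∷ (4 , 2) ∷ (5 , 1) ∷ (5 , 2) ∷ []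
  μ₂ = (0 , 1) ∷ (0 , 2) ∷ (1 , 2) ∷ (4 , 3) ∷ (5 , 3) ∷ (5 , 4) ∷ []
  mirrored? : ∀ μ μ′ → Dec (All (MirroredIn 5 μ) μ′)
  mirrored? μ μ′ = All.all? (λ (i , j) → (i ≤? 5) ×-dec ((5 ∸ i , j) ∈? μ)) μ′

lemma5p3 : SameClass (v2-41-3 ∷ v3-41-2 ∷ p1 ∷ []) (c2413 ∷ v3-41-2 ∷ [])
           × SameClass (v2-41-3 ∷ v3-14-2 ∷ p1 ∷ []) (c2413 ∷ v3-14-2 ∷ [])
           × SameClass (v3-14-2 ∷ v2-14-3 ∷ p2 ∷ []) (c3142 ∷ v2-14-3 ∷ [])
           × SameClass (v3-14-2 ∷ v2-41-3 ∷ p2 ∷ []) (c3142 ∷ v2-41-3 ∷ [])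
lemma5p3 =
  identity₁ ,
  identity₂ ,
  SameClass-reverse (3-14-2-reverses-2-41-3 ∷ 2-14-3-reverses-3-41-2 ∷ p2-reverses-p1 ∷ [])
                    (3142-reverses-2413 ∷ 2-14-3-reverses-3-41-2 ∷ []) identity₁ ,
  SameClass-reverse (3-14-2-reverses-2-41-3 ∷ 2-41-3-reverses-3-14-2 ∷ p2-reverses-p1 ∷ [])
                    (3142-reverses-2413 ∷ 2-41-3-reverses-3-14-2 ∷ []) identity₂
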